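{- Let $\mathcal{L}_1=\{\{i\}\cup\{k\in\omega:k\ge j\}: i,j\in\omega\}$. Then: (1) $\mathcal{L}_1$ has no infinite antichain with respect to $\subseteq$; (2) the partial ordering $(\mathcal{L}_1,\supseteq)$ is order-isomorphic to $\mathrm{PF}((\mathcal{L}_1,\supseteq))$, and both are well quasi-orderings; (3) neither $(\mathcal{L}_1,\supseteq)$ nor $\mathrm{PF}((\mathcal{L}_1,\supseteq))$ is a better quasi-ordering; (4) neither $\mathcal{L}_1$ nor $|\mathrm{PF}((\mathcal{L}_1,\supseteq))|$ is a better elastic set system; (5) $(\mathcal{L}_1)^{<\omega}$ is not a finitely elastic set system, but $|\mathrm{PF}((\mathcal{L}_1,\supseteq))|^{<\omega}$ is.
   Context: For a quasi-ordering $\mathcal{X}=(X,\preceq)$, a principal filter is a set $\{y\in X:x\preceq y\}$ for some $x\in X$; $|\mathrm{PF}(\mathcal{X})|$ is the set of principal filters (a set system over $X$), and $\mathrm{PF}(\mathcal{X})$ is this set ordered by reverse inclusion. For a set system $\mathcal{L}$, $\mathcal{L}^{<\omega}=\{\bigcup\mathcal{M}:\emptyset\ne\mathcal{M}\subseteq\mathcal{L},\ \mathcal{M}\text{ finite}\}$, and $\mathrm{qo}(\mathcal{L})$ is the quasi-ordering on $\bigcup\mathcal{L}$ with $x\preceq y$ iff every member containing $x$ contains $y$. A well quasi-ordering has no infinite antichain and no infinite strictly descending chain. Better quasi-ordering (BQO): a barrier is a family $B$ of finite subsets of $\omega$ (identified with increasing sequences) with $\bigcup B$ infinite, every infinite $\sigma\subseteq\bigcup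 B$ having a member of $B$ as a prefix, and no member a proper subset of another; $s\triangleleft t$ means $s$ is a prefix of $u=s\cup t$ and $t$ a prefix of $u\setminus\{\min u\}$; $(Q,\preceq)$ is a BQO if for every barrier $B$ and every $f:B\to Q$ there are $s\triangleleft t$ in $B$ with $f(s)\preceq f(t)$. A set system $\mathcal{L}$ is a better elastic set system if $\mathrm{qo}(\mathcal{L})$ is a BQO. A learning sequence of $\mathcal{L}$ is $\langle\langle t_0,A_1\rangle,\langle t_1,A_2\rangle,\ldots\rangle$ with $A_{i+1}\in\mathcal{L}$, $\{t_0,\ldots,t_i\}\subseteq A_{i+1}$; bad if $t_{i+1}\notin A_{i+1}$ for all $i$; $\mathcal{L}$ is a finitely elastic set system if it has no infinite bad learning sequence. -}

module Defs where

open import Level using (Level; _⊔_) renaming (suc to lsuc; zero to lzero)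
open import Data.Nat using (ℕ; zero; suc; _≤_; _<_)
open import Data.Fin using (Fin)
open import Data.List using (List; []; _∷_; _++_; length; map; upTo; drop)
open import Data.List.Membership.Propositional using (_∈_)
open import Data.List.Relation.Binary.Subset.Propositional using (_⊆_)
open import Data.List.Relation.Unary.Linked using (Linked)
open import Data.Product using (Σ; ∃; ∃₂; _×_; _,_; proj₁)
open import Data.Sum using (_⊎_)
open import Relation.Binary.PropositionalEquality using (_≡_; _≢_)
open import Relation.Nullary using (¬_)

private variable a q r ℓ : Level

Sub : Set a → Set (a ⊔ lsuc lzero)
Sub X = X → Set

_≐_ : {X : Set a} → Sub X → Sub X → Set a
A ≐ B = ∀ x → (A x → B x) × (B x → A x)

SetSystem : Set a → (ℓ : Level) → Set (a ⊔ lsuc lzero ⊔ lsuc ℓ)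
SetSystem X ℓ = Sub X → Set ℓ

Antichain : {Q : Set q} → (Q → Q → Set r) → (ℕ → Q) → Set r
Antichain R f = ∀ i j → i ≢ j → ¬ R (f i) (f j)

Descending : {Q : Set q} → (Q → Q → Set r) → (ℕ → Q) → Set r
Descending R f = ∀ i → R (f (suc i)) (f i) × ¬ R (f i) (f (suc i))

WQO : {Q : Set q} → (Q → Q → Set r) → Set (q ⊔ r)
WQO {Q = Q} R =
  (∀ x → R x x) × (∀ x y z → R x y → R y z → R x z) ×
  ¬ (∃ λ (f : ℕ → Q) → Antichain R f) × ¬ (∃ λ (f : ℕ → Q) → Descending R f)

-- order isomorphism (up to the equivalence induced by the orders, which
-- for partial orders of sets is extensional equality)
OrderIso : {A : Set a} {B : Set q} → (A → A → Set r) → (B → B → Set ℓ) →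
           Set (a ⊔ q ⊔ r ⊔ ℓ)
OrderIso {A = A} {B = B} R S =
  Σ (A → B) λ f → Σ (B → A) λ g →
    (∀ x y → (R x y → S (f x) (f y)) × (S (f x) (f y) → R x y)) ×
    (∀ x → R (g (f x)) x × R x (g (f x))) ×
    (∀ y → S (f (g y)) y × S y (f (g y)))

-- Barriers and better quasi-orderings.
-- Finite subsets of ω are strictly increasing lists.

IncSeq : (ℕ → ℕ) → Set
IncSeq σ = ∀ n → σ n < σ (suc n)

record Barrier (B : List ℕ → Set) : Set where
  field
    sorted    : ∀ s → B s → Linked _<_ s
    infinite  : ∀ n → ∃ λ m → n ≤ m × (∃ λ s → B s × m ∈ s)
    prefix    : ∀ σ → IncSeq σ → (∀ n → ∃ λ s → B s × σ n ∈ s) →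
                ∃ λ s → B s × s ≡ map σ (upTo (length s))
    antichain : ∀ s t → B s → B t → s ⊆ t → t ⊆ s

Prefix : List ℕ → List ℕ → Set
Prefix s u = ∃ λ r → s ++ r ≡ u

_◁_ : List ℕ → List ℕ → Set
s ◁ t = ∃ λ u → Linked _<_ u ×
          (∀ n → (n ∈ u → n ∈ s ⊎ n ∈ t) × (n ∈ s ⊎ n ∈ t → n ∈ u)) ×
          Prefix s u × Prefix t (drop 1 u)

BQO : {Q : Set q} → (Q → Q → Set r) → Set (q ⊔ r ⊔ lsuc lzero)
BQO {Q = Q} R =
  ∀ (B : List ℕ → Set) → Barrier B → (f : ∀ s → B s → Q) →
    ∃₂ λ s t → Σ (B s) λ bs → Σ (B t) λ bt → s ◁ t × R (f s bs) (f t bt)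

PF∣ : {Q : Set q} → (Q → Q → Set) → SetSystem Q q
PF∣ R F = ∃ λ x → ∀ y → (F y → R x y) × (R x y → F y)

PFCarrier : {Q : Set q} → (Q → Q → Set) → Set (q ⊔ lsuc lzero)
PFCarrier {Q = Q} R = Σ (Sub Q) (PF∣ R)

PFord : {Q : Set q} → (R : Q → Q → Set) → PFCarrier R → PFCarrier R → Set q
PFord R (F , _) (G , _) = ∀ y → G y → F y

⋃ : {X : Set a} → SetSystem X ℓ → X → Set (a ⊔ lsuc lzero ⊔ ℓ)
⋃ 𝓛 x = ∃ λ A → 𝓛 A × A x

QOCarrier : {X : Set a} → SetSystem X ℓ → Set (a ⊔ lsuc lzero ⊔ ℓ)
QOCarrier {X = X} 𝓛 = Σ X (⋃ 𝓛)

qo : {X : Set a} (𝓛 : SetSystem X ℓ) → QOCarrier 𝓛 → QOCarrier 𝓛 →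
     Set (a ⊔ lsuc lzero ⊔ ℓ)
qo 𝓛 (x , _) (y , _) = ∀ A → 𝓛 A → A x → A y

BetterElastic : {X : Set a} → SetSystem X ℓ → Set (a ⊔ lsuc lzero ⊔ ℓ)
BetterElastic 𝓛 = BQO (qo 𝓛)

_<ω : {X : Set a} → SetSystem X ℓ → SetSystem X (a ⊔ lsuc lzero ⊔ ℓ)
_<ω {X = X} 𝓛 A =
  ∃₂ λ n (M : Fin (suc n) → Sub X) →
    (∀ k → 𝓛 (M k)) × (A ≐ λ x → ∃ λ k → M k x)

-- A learning sequence ⟨⟨t₀,A₁⟩,⟨t₁,A₂⟩,…⟩; here A i stands for A_{i+1}.
record LearningSeq {X : Set a} (𝓛 : SetSystem X ℓ) : Set (a ⊔ lsuc lzero ⊔ ℓ) where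
  field
    t    : ℕ → X
    A    : ℕ → Sub X
    inL  : ∀ i → 𝓛 (A i)
    cons : ∀ i k → k ≤ i → A i (t k)

Bad : {X : Set a} {𝓛 : SetSystem X ℓ} → LearningSeq 𝓛 → Set
Bad L = ∀ i → ¬ A i (t (suc i))
  where open LearningSeq L

FinitelyElastic : {X : Set a} → SetSystem X ℓ → Set (a ⊔ lsuc lzero ⊔ ℓ)
FinitelyElastic 𝓛 = ¬ (Σ (LearningSeq 𝓛) Bad)

𝓛₁ : SetSystem ℕ lzero
𝓛₁ A = ∃₂ λ i j → A ≐ (λ k → k ≡ i ⊎ j ≤ k)

L₁ : Set₁
L₁ = Σ (Sub ℕ) 𝓛₁

_⊇₁_ : L₁ → L₁ → Set
(A , _) ⊇₁ (B , _) = ∀ k → B k → A k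

_⊆₁_ : L₁ → L₁ → Set
(A , _) ⊆₁ (B , _) = ∀ k → A k → B k

-- Writing the members of 𝓛₁ as {i} ∪ [j,∞), the pairs (i , j) carry an order ≼ that implies ⊇,
-- and every sequence of pairs has k < m with f k ≼ f m: by induction on B, either a good pair
-- appears or some term has min(i , j) ≥ B; raising B to B + 1 searches forward among the terms
-- of height exactly B, whose j-coordinates cannot decrease forever.  So (𝓛₁, ⊇) is well
-- quasi-ordered, which gives (1), (2) and the finite elasticity in (5), because members of
-- |PF|^{<ω} are upward closed.  Failure of BQO comes from the barrier of pairs [a , b], sent to
-- {a} ∪ (b,∞): for a < b, the set {a} ∪ (b,∞) misses b, while {b} ∪ (d,∞) contains it.
module Submission where

open import Defs
open import Data.Nat using (ℕ)
open import Data.Product using (∃; _×_)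
open import Relation.Nullary using (¬_)

open import Level using (Level)
open import Function using (_∘_)
open import Data.Nat using (zero; suc; _+_; _≤_; _<_; _⊓_; _≤′_; ≤′-refl; ≤′-step; z≤n; s≤s)
open import Data.Nat.Properties
open import Data.Nat.Induction using (<-wellFounded)
open import Induction.WellFounded using (Acc; acc)
open import Data.Fin using (Fin; toℕ; fromℕ<)
open import Data.Fin.Properties using (toℕ<n; toℕ-fromℕ<)
open import Data.List using (List; []; _∷_)
open import Data.List.Membership.Propositional using (_∈_)
open import Data.List.Relation.Unary.Any using (here; there)
open import Data.List.Relation.Unary.Linked using ([-]; _∷_)
open import Data.Product using (∃₂; _,_; proj₁; proj₂)
open import Data.Sum using (_⊎_; inj₁; inj₂)
open import Data.Empty using (⊥; ⊥-elim)
open import Relation.Binary.PropositionalEquality using (_≡_; refl; sym; trans)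

private variable
  a p q r : Level
  Q : Set q

-- Explicit-argument variants of Reflexive and Transitive: _⊇₁_ matches on pairs, so Agda
-- cannot infer the implicit points of the library versions.
Reflexive′ Transitive′ : (Q → Q → Set r) → Set _
Reflexive′ R = ∀ x → R x x
Transitive′ R = ∀ x y z → R x y → R y z → R x z

record Good (R : Q → Q → Set r) (f : ℕ → Q) : Set r where
  constructor good
  field
    k m     : ℕ
    k<m     : k < m
    related : R (f k) (f m)

Good-drop : ∀ {R : Q → Q → Set r} {f} s → Good R (f ∘ (s +_)) → Good R f
Good-drop s (good k m k<m fk≤fm) = good (s + k) (s + m) (+-monoʳ-< s k<m) fk≤fm

Good-reflect : ∀ {A : Set a} {R : A → A → Set r} {S : Q → Q → Set p} (g : Q → A) →
               (∀ x y → R (g x) (g y) → S x y) → ∀ {f} → Good R (g ∘ f) → Good S f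
Good-reflect g reflect (good k m k<m gfk≤gfm) = good k m k<m (reflect _ _ gfk≤gfm)

module _ {R : Q → Q → Set r} (all-good : ∀ f → Good R f) where

  good⇒¬antichain : ∀ f → ¬ Antichain R f
  good⇒¬antichain f anti with all-good f
  ... | good k m k<m fk≤fm = anti k m (<⇒≢ k<m) fk≤fm

  good⇒¬descending : Reflexive′ R → Transitive′ R → ∀ f → ¬ Descending R f
  good⇒¬descending refl′ trans′ f desc with all-good f
  ... | good k m k<m fk≤fm =
    proj₂ (desc k) (trans′ _ _ _ fk≤fm (descends (≤⇒≤′ k<m)))
    where
    descends : ∀ {n m} → n ≤′ m → R (f m) (f n)
    descends ≤′-refl        = refl′ _
    descends (≤′-step n≤′m) = trans′ _ _ _ (proj₁ (desc _)) (descends n≤′m)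

  good⇒wqo : Reflexive′ R → Transitive′ R → WQO R
  good⇒wqo refl′ trans′ =
    refl′ , trans′ ,
    (λ (f , anti) → good⇒¬antichain f anti) ,
    (λ (f , desc) → good⇒¬descending refl′ trans′ f desc)

good⇒finitelyElastic : ∀ {X : Set a} {ℓ} {𝓛 : SetSystem X ℓ} {R : X → X → Set r} →
  (∀ f → Good R f) → (∀ {A x y} → 𝓛 A → A x → R x y → A y) → FinitelyElastic 𝓛
good⇒finitelyElastic {R = R} all-good upward (L , bad) = refute (all-good t)
  where
  open LearningSeq L
  refute : Good R t → ⊥
  refute (good k (suc i) (s≤s k≤i) tk≤ti+1) = bad i (upward (inL i) (cons i k k≤i) tk≤ti+1)

module PrincipalFilters (R : Q → Q → Set) (refl′ : Reflexive′ R) (trans′ : Transitive′ R) where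

  principal : Q → PFCarrier R
  principal x = R x , x , λ _ → (λ p → p) , (λ p → p)

  generator : PFCarrier R → Q
  generator (_ , x , _) = x

  PFord⇒ : ∀ F G → PFord R F G → R (generator F) (generator G)
  PFord⇒ (_ , x , F≐) (_ , y , G≐) F⊇G = proj₁ (F≐ y) (F⊇G y (proj₂ (G≐ y) (refl′ y)))

  ⇒PFord : ∀ F G → R (generator F) (generator G) → PFord R F G
  ⇒PFord (_ , x , F≐) (_ , y , G≐) x≤y z Gz = proj₂ (F≐ z) (trans′ _ _ _ x≤y (proj₁ (G≐ z) Gz))

  PF-orderIso : OrderIso R (PFord R)
  PF-orderIso =
    principal , generator ,
    (λ x y → ⇒PFord (principal x) (principal y) , PFord⇒ (principal x) (principal y)) ,
    (λ x → refl′ x , refl′ x) ,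
    (λ F → ⇒PFord (principal (generator F)) F (refl′ _) ,
           ⇒PFord F (principal (generator F)) (refl′ _))

  PFord-wqo : (∀ f → Good R f) → WQO (PFord R)
  PFord-wqo all-good =
    good⇒wqo (λ f → Good-reflect generator ⇒PFord (all-good (generator ∘ f)))
      (λ _ _ p → p) (λ _ _ _ F⊇G G⊇H z → F⊇G z ∘ G⊇H z)

  principal-point : Q → QOCarrier (PF∣ R)
  principal-point x = x , proj₁ (principal x) , proj₂ (principal x) , refl′ x

  qo-PF⇒ : ∀ x y → qo (PF∣ R) x y → R (proj₁ x) (proj₁ y)
  qo-PF⇒ (x , _) _ x≤y = x≤y (R x) (proj₂ (principal x)) (refl′ x)

  PF<ω-upward : ∀ {A x y} → (PF∣ R <ω) A → A x → R x y → A y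
  PF<ω-upward {A} {x} {y} (_ , M , M-PF , A≐) Ax x≤y with proj₁ (A≐ x) Ax
  ... | l , Mlx with M-PF l
  ...   | _ , Ml≐ = proj₂ (A≐ y) (l , proj₂ (Ml≐ y) (trans′ _ _ _ (proj₁ (Ml≐ x) Mlx) x≤y))

_≼_ : ℕ × ℕ → ℕ × ℕ → Set
(i , j) ≼ (i′ , j′) = j ≤ j′ × (i′ ≡ i ⊎ j ≤ i′)

height : ℕ × ℕ → ℕ
height (i , j) = i ⊓ j

≼-of-≤-height : ∀ p q → proj₂ p ≤ height q → p ≼ q
≼-of-≤-height (i , j) (i′ , j′) j≤h = ≤-trans j≤h (m⊓n≤n i′ j′) , inj₂ (≤-trans j≤h (m⊓n≤m i′ j′))

≼-of-≡-height : ∀ p q → height p ≡ height q → proj₂ p ≤ proj₂ q → p ≼ q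
≼-of-≡-height (i , j) (i′ , j′) h≡h′ j≤j′ with ≤-<-connex j i′
... | inj₁ j≤i′ = j≤j′ , inj₂ j≤i′
... | inj₂ i′<j = j≤j′ , inj₁ (i′≡i (⊓-sel i j))
  where
  i′≡i⊓j : i′ ≡ i ⊓ j
  i′≡i⊓j = trans (sym (m≤n⇒m⊓n≡m (<⇒≤ (<-≤-trans i′<j j≤j′)))) (sym h≡h′)

  i′≡i : i ⊓ j ≡ i ⊎ i ⊓ j ≡ j → i′ ≡ i
  i′≡i (inj₁ i⊓j≡i) = trans i′≡i⊓j i⊓j≡i
  i′≡i (inj₂ i⊓j≡j) = ⊥-elim (<-irrefl (trans i′≡i⊓j i⊓j≡j) i′<j)

Reaches : ℕ → (ℕ → ℕ × ℕ) → Set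
Reaches B f = ∃ λ m → B ≤ height (f m)

raise-height : ∀ {B} → (∀ g → Good _≼_ g ⊎ Reaches B g) →
        ∀ f a → B ≤ height (f a) → Acc _<_ (proj₂ (f a)) → Good _≼_ f ⊎ Reaches (suc B) f
raise-height hyp f a B≤ha (acc smaller) with m≤n⇒m<n∨m≡n B≤ha
... | inj₁ B<ha = inj₂ (a , B<ha)
... | inj₂ B≡ha with hyp (f ∘ (suc a +_))
...   | inj₁ tail-good = inj₁ (Good-drop (suc a) tail-good)
...   | inj₂ (m , B≤hb) with m≤n⇒m<n∨m≡n B≤hb
...     | inj₁ B<hb = inj₂ (suc a + m , B<hb)
...     | inj₂ B≡hb with ≤-<-connex (proj₂ (f a)) (proj₂ (f (suc a + m)))
...       | inj₁ ja≤jb = inj₁ (good a (suc a + m) (s≤s (m≤m+n a m))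
                               (≼-of-≡-height (f a) (f (suc a + m)) (trans (sym B≡ha) B≡hb) ja≤jb))
...       | inj₂ jb<ja = raise-height hyp f (suc a + m) B≤hb (smaller jb<ja)

good⊎reaches : ∀ B f → Good _≼_ f ⊎ Reaches B f
good⊎reaches zero    f = inj₂ (0 , z≤n)
good⊎reaches (suc B) f with good⊎reaches B f
... | inj₁ f-good    = inj₁ f-good
... | inj₂ (m , B≤h) = raise-height (good⊎reaches B) f m B≤h (<-wellFounded _)

≼-good : ∀ f → Good _≼_ f
≼-good f with good⊎reaches (proj₂ (f 0)) (f ∘ suc)
... | inj₁ tail-good = Good-drop 1 tail-good
... | inj₂ (m , j≤h) = good 0 (suc m) (s≤s z≤n) (≼-of-≤-height (f 0) (f (suc m)) j≤h)

parameters : L₁ → ℕ × ℕ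
parameters (_ , i , j , _) = i , j

≼⇒⊇₁ : ∀ x y → parameters x ≼ parameters y → x ⊇₁ y
≼⇒⊇₁ (_ , _ , _ , A≐) (_ , _ , _ , B≐) (j≤j′ , i′≡i⊎j≤i′) k Bk with proj₁ (B≐ k) Bk
... | inj₁ refl  = proj₂ (A≐ k) i′≡i⊎j≤i′
... | inj₂ j′≤k = proj₂ (A≐ k) (inj₂ (≤-trans j≤j′ j′≤k))

⊇₁-good : ∀ f → Good _⊇₁_ f
⊇₁-good f = Good-reflect parameters ≼⇒⊇₁ (≼-good (parameters ∘ f))

⊇₁-refl : Reflexive′ _⊇₁_
⊇₁-refl _ _ p = p

⊇₁-trans : Transitive′ _⊇₁_
⊇₁-trans _ _ _ x⊇y y⊇z k = x⊇y k ∘ y⊇z k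

open PrincipalFilters _⊇₁_ ⊇₁-refl ⊇₁-trans

Pair : List ℕ → Set
Pair s = ∃₂ λ a b → a < b × s ≡ a ∷ b ∷ []

∈-pair : ∀ {x c d : ℕ} → x ∈ c ∷ d ∷ [] → x ≡ c ⊎ x ≡ d
∈-pair (here x≡c)         = inj₁ x≡c
∈-pair (there (here x≡d)) = inj₂ x≡d

pair-⊆-reverse : ∀ {a b c d} → a < b →
  (∀ {x} → x ∈ a ∷ b ∷ [] → x ∈ c ∷ d ∷ []) → ∀ {x} → x ∈ c ∷ d ∷ [] → x ∈ a ∷ b ∷ []
pair-⊆-reverse a<b sub x∈cd
  with ∈-pair (sub (here refl)) | ∈-pair (sub (there (here refl))) | ∈-pair x∈cd
... | inj₁ refl | inj₁ refl | _         = ⊥-elim (<-irrefl refl a<b)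
... | inj₁ refl | inj₂ refl | inj₁ refl = here refl
... | inj₁ refl | inj₂ refl | inj₂ refl = there (here refl)
... | inj₂ refl | inj₁ refl | inj₁ refl = there (here refl)
... | inj₂ refl | inj₁ refl | inj₂ refl = here refl
... | inj₂ refl | inj₂ refl | _         = ⊥-elim (<-irrefl refl a<b)

pair-barrier : Barrier Pair
pair-barrier = record
  { sorted    = λ { _ (_ , _ , a<b , refl) → a<b ∷ [-] }
  ; infinite  = λ n → suc n , n≤1+n n , (n ∷ suc n ∷ []) , (n , suc n , n<1+n n , refl) ,
                      there (here refl)
  ; prefix    = λ σ σ-inc _ → (σ 0 ∷ σ 1 ∷ []) , (σ 0 , σ 1 , σ-inc 0 , refl) , refl
  ; antichain = λ { _ _ (_ , _ , a<b , refl) (_ , _ , _ , refl) sub → pair-⊆-reverse a<b sub }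
  }

◁-pair : ∀ {a b c d} → (a ∷ b ∷ []) ◁ (c ∷ d ∷ []) → c ≡ b
◁-pair (_ , _ , _ , (_ , refl) , (_ , refl)) = refl

bad-on-pairs⇒¬bqo : (R : Q → Q → Set r) (F : ℕ → ℕ → Q) →
  (∀ {a b d} → a < b → ¬ R (F a b) (F b d)) → ¬ BQO R
bad-on-pairs⇒¬bqo R F bad bqo
  with bqo Pair pair-barrier (λ { _ (a , b , _ , _) → F a b })
... | _ , _ , (_ , _ , a<b , refl) , (_ , _ , _ , refl) , s◁t , Fab≤Fbd
  with ◁-pair s◁t
... | refl = bad a<b Fab≤Fbd

bqo-reflect : ∀ {A : Set a} (R : A → A → Set r) (S : Q → Q → Set p) (h : Q → A) →
  (∀ x y → R (h x) (h y) → S x y) → BQO R → BQO S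
bqo-reflect R S h reflect bqo B barrier f
  with bqo B barrier (λ u bu → h (f u bu))
... | u , v , bu , bv , u◁v , hfu≤hfv = u , v , bu , bv , u◁v , reflect _ _ hfu≤hfv

point∪from : ℕ → ℕ → L₁
point∪from i j = (λ k → k ≡ i ⊎ j ≤ k) , i , j , λ _ → (λ p → p) , (λ p → p)

∉point∪from : ∀ {a b} → a < b → ¬ proj₁ (point∪from a (suc b)) b
∉point∪from a<b (inj₁ b≡a)  = <-irrefl (sym b≡a) a<b
∉point∪from a<b (inj₂ b<b) = <-irrefl refl b<b

⊇₁-¬bqo : ¬ BQO _⊇₁_
⊇₁-¬bqo = bad-on-pairs⇒¬bqo _⊇₁_ (λ a b → point∪from a (suc b))
  (λ a<b ⊇ → ∉point∪from a<b (⊇ _ (inj₁ refl)))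

𝓛₁-¬betterElastic : ¬ BetterElastic 𝓛₁
𝓛₁-¬betterElastic = bad-on-pairs⇒¬bqo (qo 𝓛₁)
  (λ a b → a , proj₁ (point∪from a (suc b)) , proj₂ (point∪from a (suc b)) , inj₁ refl)
  (λ a<b a≤b → ∉point∪from a<b (a≤b _ (proj₂ (point∪from _ _)) (inj₁ refl)))

PFord-¬bqo : ¬ BQO (PFord _⊇₁_)
PFord-¬bqo = ⊇₁-¬bqo ∘ bqo-reflect (PFord _⊇₁_) _⊇₁_ principal
  (λ x y → PFord⇒ (principal x) (principal y))

PF-¬betterElastic : ¬ BetterElastic (PF∣ _⊇₁_)
PF-¬betterElastic = ⊇₁-¬bqo ∘ bqo-reflect (qo (PF∣ _⊇₁_)) _⊇₁_ principal-point
  (λ x y → qo-PF⇒ (principal-point x) (principal-point y))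

-- A i = {0, …, i} ∪ [i + 2, ∞) contains t 0, …, t i for t n = n, but not t (i + 1).

interval∪from : ℕ → Sub ℕ
interval∪from i x = ∃ λ (k : Fin (suc i)) → proj₁ (point∪from (toℕ k) (suc (suc i))) x

counting : LearningSeq (𝓛₁ <ω)
counting = record
  { t    = λ n → n
  ; A    = interval∪from
  ; inL  = λ i → i , (λ k → proj₁ (point∪from (toℕ k) (suc (suc i)))) ,
                 (λ k → proj₂ (point∪from (toℕ k) (suc (suc i)))) ,
                 (λ _ → (λ p → p) , (λ p → p))
  ; cons = λ i k k≤i → fromℕ< (s≤s k≤i) , inj₁ (sym (toℕ-fromℕ< (s≤s k≤i)))
  }

counting-bad : Bad counting
counting-bad i (k , inj₁ i+1≡k)   = <-irrefl (sym i+1≡k) (toℕ<n k)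
counting-bad i (k , inj₂ i+2≤i+1) = <-irrefl refl i+2≤i+1

lemma10 : (¬ (∃ λ (f : ℕ → L₁) → Antichain _⊆₁_ f)) ×
    (OrderIso _⊇₁_ (PFord _⊇₁_) × WQO _⊇₁_ × WQO (PFord _⊇₁_)) ×
    (¬ BQO _⊇₁_ × ¬ BQO (PFord _⊇₁_)) ×
    (¬ BetterElastic 𝓛₁ × ¬ BetterElastic (PF∣ _⊇₁_)) ×
    (¬ FinitelyElastic (𝓛₁ <ω) × FinitelyElastic ((PF∣ _⊇₁_) <ω))
lemma10 =
  (λ (f , anti) → good⇒¬antichain ⊇₁-good f λ i j i≢j → anti j i (i≢j ∘ sym)) ,
  (PF-orderIso , good⇒wqo ⊇₁-good ⊇₁-refl ⊇₁-trans , PFord-wqo ⊇₁-good) ,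
  (⊇₁-¬bqo , PFord-¬bqo) ,
  (𝓛₁-¬betterElastic , PF-¬betterElastic) ,
  ((λ fe → fe (counting , counting-bad)) , good⇒finitelyElastic ⊇₁-good PF<ω-upward)
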